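{- Let $m\ge 2$ and let $(a_0,a_1,\dots,a_m)$ be a sequence of positive integers such that for every $0\le i\le m-1$, $a_i=b_{i+1}a_{i+1}$ for some integer $b_{i+1}\ge 2$. Then for every choice of integers $\eta_1,\dots,\eta_m$ with $1\le\eta_i\le b_i-1$, there exists a non-disjoint $$\Big(a_0,\,m,\,\eta_1a_1,\,\eta_2a_2\tfrac{a_0}{a_1},\,\eta_3a_3\tfrac{a_0}{a_2},\,\dots,\,\eta_ma_m\tfrac{a_0}{a_{m-1}}\Big)\text{ -GPSEDF in }\mathbb{Z}_{a_0},$$ and its $\lambda$-matrix $[a_{ij}]_{m\times m}$ has $a_{ii}=0$ and $a_{ij}=\lambda_{i,j}=\frac{a_0\eta_ia_i\eta_ja_j}{a_{i-1}a_{j-1}}$ for $i\ne j$.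
   Context: For subsets $A,B$ of an additively written group $G$, $\Delta(A,B)$ denotes the multiset $\{a-b:a\in A,b\in B\}$ (one entry per pair). For $\lambda\in\mathbb{N}\cup\{0\}$, $\lambda G$ is the multiset containing every element of $G$ exactly $\lambda$ times. Let $|G|=v$. A family of sets $\{A_1,\dots,A_m\}$ in $G$ with $|A_i|=k_i$ is a non-disjoint $(v,m,k_1,\dots,k_m)$-GPSEDF if $\Delta(A_i,A_j)=\lambda_{i,j}G$ with $\lambda_{i,j}=k_ik_j/v$ for all $1\le i\ne j\le m$. Its $\lambda$-matrix is the $m\times m$ matrix with diagonal entries $0$ and $(i,j)$ entry $\lambda_{i,j}$ for $i\neq j$. -}

module Defs where

open import Data.Nat using (ℕ; zero; suc; _+_; _*_; _∸_)
open import Data.Nat.DivMod using (_/_; _%_)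
open import Data.Fin using (Fin; toℕ)
open import Data.List using (List; length; filter; cartesianProduct)
open import Data.List.Relation.Unary.Unique.Propositional using (Unique)
open import Data.Product using (_×_; _,_; proj₁; proj₂)
open import Relation.Binary.PropositionalEquality using (_≡_; _≢_)
open import Data.Nat.Properties using (_≟_)
import Data.Fin as F
open import Relation.Nullary using (yes; no)

-- Natural-number division / remainder, total: returns 0 on divisor 0.
-- (Only ever used with positive divisors in the statement.)
_div_ : ℕ → ℕ → ℕ
n div zero = 0
n div suc d = n / suc d

_mod_ : ℕ → ℕ → ℕ
n mod zero = n
n mod suc d = n % suc d

-- The cyclic group Z_v is represented by Fin v (residues 0..v-1).
-- Difference a - b in Z_v, as a residue in ℕ.
subℤ : (v : ℕ) → Fin v → Fin v → ℕ
subℤ v a b = (toℕ a + (v ∸ toℕ b)) mod v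

-- Multiplicity of g in the multiset Δ(A,B) = {a - b : a ∈ A, b ∈ B}
-- (one entry per pair (a,b)).
Δcount : (v : ℕ) → List (Fin v) → List (Fin v) → Fin v → ℕ
Δcount v A B g =
  length (filter (λ p → subℤ v (proj₁ p) (proj₂ p) ≟ toℕ g) (cartesianProduct A B))

ΔIsMultipleOfG : (v : ℕ) → List (Fin v) → List (Fin v) → ℕ → Set
ΔIsMultipleOfG v A B λ′ = (g : Fin v) → Δcount v A B g ≡ λ′

-- A set in Z_v: a duplicate-free list of elements; its size is its length.
-- Non-disjoint (v, m, k_1..k_m)-GPSEDF in Z_v (family indexed by Fin m,
-- index i : Fin m corresponding to the paper's index toℕ i + 1):
-- |A_i| = k_i and Δ(A_i,A_j) = (k_i k_j / v) G for i ≠ j.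
-- (Non-disjoint: no disjointness requirement on the A_i.)
IsGPSEDF : (v m : ℕ) → (k : Fin m → ℕ) → (A : Fin m → List (Fin v)) → Set
IsGPSEDF v m k A =
  ((i : Fin m) → Unique (A i) × length (A i) ≡ k i) ×
  ((i j : Fin m) → i ≢ j → ΔIsMultipleOfG v (A i) (A j) ((k i * k j) div v))

lambdaMatrix : (v m : ℕ) → (k : Fin m → ℕ) → Fin m → Fin m → ℕ
lambdaMatrix v m k i j with i F.≟ j
... | yes _ = 0
... | no _ = (k i * k j) div v

blockSize : (a η : ℕ → ℕ) → ℕ → ℕ
blockSize a η (suc zero) = η 1 * a 1
blockSize a η p = η p * a p * (a 0 div a (p ∸ 1))

pix : {m : ℕ} → Fin m → ℕ
pix i = suc (toℕ i)

{-# OPTIONS --safe #-}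
-- Take A_i = {x ∈ ℤ_{a_0} : x mod a_{i-1} < η_i a_i}, so |A_i| = η_i a_i a_0 / a_{i-1}.
-- For i < j the modulus a_{j-1} divides a_{i-1} and a_i, so A_i is a union of
-- (a_0 / a_{i-1}) (η_i a_i / a_{j-1}) intervals of length a_{j-1}, while A_j is
-- a_{j-1}-periodic with η_j a_j points per period. Every translate of such an interval
-- therefore meets A_j in exactly η_j a_j points, so each difference g occurs the same
-- number of times in Δ(A_i, A_j), and likewise in Δ(A_j, A_i).
module Submission where

open import Defs
open import Data.Fin as Fin using (Fin; toℕ)
open import Data.Fin.Properties using (toℕ<n; toℕ-injective)
open import Data.List
  using (List; []; _∷_; length; filter; cartesianProduct; allFin; tabulate; map; _++_)
open import Data.List.Properties using (map-++; map-∘; map-cong; map-tabulate)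
open import Data.List.Relation.Unary.Unique.Propositional using (Unique)
import Data.List.Relation.Unary.Unique.Propositional.Properties as Unique
open import Data.Nat
open import Data.Nat.DivMod hiding (_mod_; _div_)
open import Data.Nat.Divisibility using (_∣_; divides; quotient; ∣-refl; ∣-trans; n∣m*n)
open import Data.Nat.ListAction using (sum)
open import Data.Nat.ListAction.Properties using (sum-++)
open import Data.Nat.Properties
open import Algebra.Properties.CommutativeSemigroup +-commutativeSemigroup
  using (x∙yz≈y∙xz; xy∙z≈yz∙x)
open import Algebra.Properties.CommutativeSemigroup *-commutativeSemigroup
  using () renaming (xy∙z≈xz∙y to m*n*o≡m*o*n)
open import Data.Nat.Tactic.RingSolver using (solve-∀)
open import Data.Product using (Σ; _×_; _,_; proj₁; proj₂)
open import Function using (_∘_; id)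
open import Level using (Level; 0ℓ)
open import Relation.Binary.Definitions using (tri<; tri≈; tri>)
open import Relation.Binary.PropositionalEquality
open import Relation.Nullary using (Dec; yes; no; ¬_; contradiction)
open import Relation.Unary using (Pred; Decidable)

private
  variable
    ℓ ℓ₁ ℓ₂ : Level
    X : Set ℓ₁
    Y : Set ℓ₂

∑< : ℕ → (ℕ → ℕ) → ℕ
∑< zero    f = 0
∑< (suc n) f = f 0 + ∑< n (f ∘ suc)

syntax ∑< n (λ x → e) = ∑[ x < n ] e

𝟙 : {P : Set ℓ} → Dec P → ℕ
𝟙 (yes _) = 1
𝟙 (no _)  = 0

𝟙-yes : {P : Set ℓ} (P? : Dec P) → P → 𝟙 P? ≡ 1
𝟙-yes (yes _) _  = refl
𝟙-yes (no ¬p) p = contradiction p ¬p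

𝟙-no : {P : Set ℓ} (P? : Dec P) → ¬ P → 𝟙 P? ≡ 0
𝟙-no (yes p) ¬p = contradiction p ¬p
𝟙-no (no _)  _  = refl

Periodic : ℕ → (ℕ → ℕ) → Set
Periodic n f = ∀ x → f (n + x) ≡ f x

∑-cong : ∀ n {f g : ℕ → ℕ} → (∀ {x} → x < n → f x ≡ g x) → ∑< n f ≡ ∑< n g
∑-cong zero    _  = refl
∑-cong (suc n) eq = cong₂ _+_ (eq z<s) (∑-cong n (eq ∘ s<s))

∑-zero : ∀ n {f : ℕ → ℕ} → (∀ {x} → x < n → f x ≡ 0) → ∑< n f ≡ 0
∑-zero zero    _  = refl
∑-zero (suc n) eq = cong₂ _+_ (eq z<s) (∑-zero n (eq ∘ s<s))

∑-ones : ∀ n → ∑[ x < n ] 1 ≡ n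
∑-ones zero    = refl
∑-ones (suc n) = cong suc (∑-ones n)

∑-+ : ∀ m n f → ∑< (m + n) f ≡ ∑< m f + ∑[ x < n ] f (m + x)
∑-+ zero    n f = refl
∑-+ (suc m) n f = trans (cong (f 0 +_) (∑-+ m n (f ∘ suc))) (sym (+-assoc (f 0) _ _))

∑-periodic : ∀ c n {f} → Periodic n f → ∑< (c * n) f ≡ c * ∑< n f
∑-periodic zero    n     _   = refl
∑-periodic (suc c) n {f} per = begin
  ∑< (n + c * n) f                   ≡⟨ ∑-+ n (c * n) f ⟩
  ∑< n f + ∑[ x < c * n ] f (n + x)  ≡⟨ cong (∑< n f +_) (∑-cong (c * n) (λ {x} _ → per x)) ⟩
  ∑< n f + ∑< (c * n) f              ≡⟨ cong (∑< n f +_) (∑-periodic c n per) ⟩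
  ∑< n f + c * ∑< n f                ∎
  where open ≡-Reasoning

-- Both ∑< (t + n) f and ∑< (n + t) f split off a copy of ∑< t f.
∑-rotate : ∀ n t {f} → Periodic n f → ∑[ x < n ] f (t + x) ≡ ∑< n f
∑-rotate n t {f} per = +-cancelˡ-≡ (∑< t f) _ _ (begin
  ∑< t f + ∑[ x < n ] f (t + x)  ≡⟨ ∑-+ t n f ⟨
  ∑< (t + n) f                   ≡⟨ cong (λ k → ∑< k f) (+-comm t n) ⟩
  ∑< (n + t) f                   ≡⟨ ∑-+ n t f ⟩
  ∑< n f + ∑[ x < t ] f (n + x)  ≡⟨ cong (∑< n f +_) (∑-cong t (λ {x} _ → per x)) ⟩
  ∑< n f + ∑< t f                ≡⟨ +-comm (∑< n f) (∑< t f) ⟩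
  ∑< t f + ∑< n f                ∎)
  where open ≡-Reasoning

∑-truncate : ∀ {L n} (f : ℕ → ℕ) → L ≤ n → ∑[ x < n ] (𝟙 (x <? L) * f x) ≡ ∑< L f
∑-truncate {L} {n} f L≤n = begin
  ∑[ x < n ] (𝟙 (x <? L) * f x)
    ≡⟨ cong (λ k → ∑[ x < k ] (𝟙 (x <? L) * f x)) (m+[n∸m]≡n L≤n) ⟨
  ∑[ x < L + (n ∸ L) ] (𝟙 (x <? L) * f x)
    ≡⟨ ∑-+ L (n ∸ L) _ ⟩
  ∑[ x < L ] (𝟙 (x <? L) * f x) + ∑[ x < n ∸ L ] (𝟙 (L + x <? L) * f (L + x))
    ≡⟨ cong₂ _+_ (∑-cong L below) (∑-zero (n ∸ L) above) ⟩
  ∑< L f + 0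
    ≡⟨ +-identityʳ _ ⟩
  ∑< L f ∎
  where
  open ≡-Reasoning
  below : ∀ {x} → x < L → 𝟙 (x <? L) * f x ≡ f x
  below {x} x<L = trans (cong (_* f x) (𝟙-yes (x <? L) x<L)) (*-identityˡ (f x))
  above : ∀ {x} → x < n ∸ L → 𝟙 (L + x <? L) * f (L + x) ≡ 0
  above {x} _ = cong (_* f (L + x)) (𝟙-no (L + x <? L) (m+n≮m L x))

%-periodic : ∀ n .{{_ : NonZero n}} (f : ℕ → ℕ) → Periodic n (f ∘ (_% n))
%-periodic n f x = cong f (%-remove-+ˡ x ∣-refl)

∑-rotate-% : ∀ n .{{_ : NonZero n}} t (f : ℕ → ℕ) → ∑[ x < n ] f ((t + x) % n) ≡ ∑< n f
∑-rotate-% n t f = trans (∑-rotate n t (%-periodic n f)) (∑-cong n (cong f ∘ m<n⇒m%n≡m))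

∑-%-below : ∀ d .{{_ : NonZero d}} t {s} → s ≤ d → ∑[ x < d ] 𝟙 ((t + x) % d <? s) ≡ s
∑-%-below d t {s} s≤d = begin
  ∑[ x < d ] 𝟙 ((t + x) % d <? s)  ≡⟨ ∑-rotate-% d t (λ y → 𝟙 (y <? s)) ⟩
  ∑[ x < d ] 𝟙 (x <? s)            ≡⟨ ∑-cong d (λ {x} _ → sym (*-identityʳ (𝟙 (x <? s)))) ⟩
  ∑[ x < d ] (𝟙 (x <? s) * 1)      ≡⟨ ∑-truncate (λ _ → 1) s≤d ⟩
  ∑[ x < s ] 1                     ≡⟨ ∑-ones s ⟩
  s                                ∎
  where open ≡-Reasoning

∑-%-truncate : ∀ c n .{{_ : NonZero n}} {L} (f : ℕ → ℕ) → L ≤ n → Periodic n f →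
               ∑[ x < c * n ] (𝟙 (x % n <? L) * f x) ≡ c * ∑< L f
∑-%-truncate c n {L} f L≤n per = begin
  ∑[ x < c * n ] (𝟙 (x % n <? L) * f x)
    ≡⟨ ∑-periodic c n (λ x → cong₂ (λ y z → 𝟙 (y <? L) * z) (%-remove-+ˡ x ∣-refl) (per x)) ⟩
  c * ∑[ x < n ] (𝟙 (x % n <? L) * f x)
    ≡⟨ cong (c *_) (∑-cong n (λ {x} x<n → cong (λ y → 𝟙 (y <? L) * f x) (m<n⇒m%n≡m x<n))) ⟩
  c * ∑[ x < n ] (𝟙 (x <? L) * f x)
    ≡⟨ cong (c *_) (∑-truncate f L≤n) ⟩
  c * ∑< L f ∎
  where open ≡-Reasoning

∑-blocks : ∀ {v n d L s} .{{_ : NonZero n}} .{{_ : NonZero d}} t →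
           (n∣v : n ∣ v) → d ∣ n → (d∣L : d ∣ L) → L ≤ n → s ≤ d →
           ∑[ x < v ] (𝟙 (x % n <? L) * 𝟙 ((t + x) % d <? s)) ≡ quotient n∣v * (quotient d∣L * s)
∑-blocks {n = n} {d} {s = s} t (divides c refl) d∣n (divides e refl) L≤n s≤d = begin
  ∑[ x < c * n ] (𝟙 (x % n <? e * d) * h x)  ≡⟨ ∑-%-truncate c n h L≤n (h-periodic d∣n) ⟩
  c * ∑< (e * d) h                            ≡⟨ cong (c *_) (∑-periodic e d (h-periodic ∣-refl)) ⟩
  c * (e * ∑< d h)                            ≡⟨ cong (λ z → c * (e * z)) (∑-%-below d t s≤d) ⟩
  c * (e * s)                                 ∎
  where
  open ≡-Reasoning
  h : ℕ → ℕ
  h x = 𝟙 ((t + x) % d <? s)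
  h-periodic : ∀ {k} → d ∣ k → Periodic k h
  h-periodic {k} d∣k x =
    cong (λ y → 𝟙 (y <? s)) (trans (cong (_% d) (x∙yz≈y∙xz t k x)) (%-remove-+ˡ (t + x) d∣k))

length-filter≡sum : {P : Pred X ℓ} (P? : Decidable P) (xs : List X) →
                    length (filter P? xs) ≡ sum (map (𝟙 ∘ P?) xs)
length-filter≡sum P? []       = refl
length-filter≡sum P? (x ∷ xs) with P? x
... | yes _ = cong suc (length-filter≡sum P? xs)
... | no _  = length-filter≡sum P? xs

sum-map-filter : {P : Pred X ℓ} (P? : Decidable P) (xs : List X) (f : X → ℕ) →
                 sum (map f (filter P? xs)) ≡ sum (map (λ x → 𝟙 (P? x) * f x) xs)
sum-map-filter P? []       f = refl
sum-map-filter P? (x ∷ xs) f with P? x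
... | yes _ = cong₂ _+_ (sym (+-identityʳ (f x))) (sum-map-filter P? xs f)
... | no _  = sum-map-filter P? xs f

sum-map-cartesianProduct : (xs : List X) (ys : List Y) (f : X × Y → ℕ) →
  sum (map f (cartesianProduct xs ys)) ≡ sum (map (λ x → sum (map (λ y → f (x , y)) ys)) xs)
sum-map-cartesianProduct []       ys f = refl
sum-map-cartesianProduct (x ∷ xs) ys f = begin
  sum (map f (map (x ,_) ys ++ cartesianProduct xs ys))
    ≡⟨ cong sum (map-++ f (map (x ,_) ys) _) ⟩
  sum (map f (map (x ,_) ys) ++ map f (cartesianProduct xs ys))
    ≡⟨ sum-++ (map f (map (x ,_) ys)) _ ⟩
  sum (map f (map (x ,_) ys)) + sum (map f (cartesianProduct xs ys))
    ≡⟨ cong₂ _+_ (cong sum (sym (map-∘ ys))) (sum-map-cartesianProduct xs ys f) ⟩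
  sum (map (f ∘ (x ,_)) ys) + sum (map (λ x → sum (map (λ y → f (x , y)) ys)) xs) ∎
  where open ≡-Reasoning

sum-tabulate : ∀ n (f : ℕ → ℕ) → sum (tabulate {n = n} (f ∘ toℕ)) ≡ ∑< n f
sum-tabulate zero    f = refl
sum-tabulate (suc n) f = cong (f 0 +_) (sum-tabulate n (f ∘ suc))

sum-map-allFin : ∀ n (f : ℕ → ℕ) → sum (map (f ∘ toℕ) (allFin n)) ≡ ∑< n f
sum-map-allFin n f = trans (cong sum (map-tabulate {n = n} id (f ∘ toℕ))) (sum-tabulate n f)

∑-select : ∀ n (f : ℕ → ℕ) {E : Pred ℕ ℓ} (E? : Decidable E) {y₀} →
           y₀ < n → E y₀ → (∀ {y} → y < n → E y → y ≡ y₀) →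
           ∑[ y < n ] (f y * 𝟙 (E? y)) ≡ f y₀
∑-select (suc n) f E? {zero} _ E0 unique = begin
  f 0 * 𝟙 (E? 0) + ∑[ y < n ] (f (suc y) * 𝟙 (E? (suc y)))
    ≡⟨ cong₂ _+_ (cong (f 0 *_) (𝟙-yes (E? 0) E0)) (∑-zero n missed) ⟩
  f 0 * 1 + 0
    ≡⟨ trans (+-identityʳ _) (*-identityʳ (f 0)) ⟩
  f 0 ∎
  where
  open ≡-Reasoning
  missed : ∀ {y} → y < n → f (suc y) * 𝟙 (E? (suc y)) ≡ 0
  missed {y} y<n =
    trans (cong (f (suc y) *_) (𝟙-no (E? (suc y)) (1+n≢0 ∘ unique (s<s y<n)))) (*-zeroʳ (f (suc y)))
∑-select (suc n) f E? {suc y₀} (s<s y₀<n) E[1+y₀] unique = begin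
  f 0 * 𝟙 (E? 0) + ∑[ y < n ] (f (suc y) * 𝟙 (E? (suc y)))
    ≡⟨ cong₂ _+_ (trans (cong (f 0 *_) (𝟙-no (E? 0) (0≢1+n ∘ unique z<s))) (*-zeroʳ (f 0))) refl ⟩
  ∑[ y < n ] (f (suc y) * 𝟙 (E? (suc y)))
    ≡⟨ ∑-select n (f ∘ suc) (E? ∘ suc) y₀<n E[1+y₀] (λ y<n → suc-injective ∘ unique (s<s y<n)) ⟩
  f (suc y₀) ∎
  where open ≡-Reasoning

[m%n+k]%n≡[m+k]%n : ∀ m k n .{{_ : NonZero n}} → (m % n + k) % n ≡ (m + k) % n
[m%n+k]%n≡[m+k]%n m k n = begin
  (m % n + k) % n          ≡⟨ %-distribˡ-+ (m % n) k n ⟩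
  (m % n % n + k % n) % n  ≡⟨ cong (λ z → (z + k % n) % n) (m%n%n≡m%n m n) ⟩
  (m % n + k % n) % n      ≡⟨ %-distribˡ-+ m k n ⟨
  (m + k) % n              ∎
  where open ≡-Reasoning

m+[n∸o]+o≡m+n : ∀ m {n o} → o ≤ n → m + (n ∸ o) + o ≡ m + n
m+[n∸o]+o≡m+n m o≤n = trans (+-assoc m _ _) (cong (m +_) (m∸n+n≡m o≤n))

[m+[n∸o]]%n≡p⇒[m+[n∸p]]%n≡o%n : ∀ n .{{_ : NonZero n}} x {y g} → y ≤ n → g ≤ n →
                   (x + (n ∸ y)) % n ≡ g → (x + (n ∸ g)) % n ≡ y % n
[m+[n∸o]]%n≡p⇒[m+[n∸p]]%n≡o%n n x {y} {g} y≤n g≤n x-y≡g = begin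
  (x + (n ∸ g)) % n  ≡⟨ cong (_% n) (+-cancelˡ-≡ g _ _ g+[x+[n∸g]]≡g+[q*n+y]) ⟩
  (q * n + y) % n    ≡⟨ %-remove-+ˡ y (n∣m*n q) ⟩
  y % n              ∎
  where
  open ≡-Reasoning
  q = (x + (n ∸ y)) / n
  g+[x+[n∸g]]≡g+[q*n+y] : g + (x + (n ∸ g)) ≡ g + (q * n + y)
  g+[x+[n∸g]]≡g+[q*n+y] = begin
    g + (x + (n ∸ g))  ≡⟨ +-comm g _ ⟩
    x + (n ∸ g) + g    ≡⟨ m+[n∸o]+o≡m+n x g≤n ⟩
    x + n              ≡⟨ m+[n∸o]+o≡m+n x y≤n ⟨
    x + (n ∸ y) + y    ≡⟨ cong (_+ y) (m≡m%n+[m/n]*n (x + (n ∸ y)) n) ⟩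
    (x + (n ∸ y)) % n + q * n + y  ≡⟨ cong (λ z → z + q * n + y) x-y≡g ⟩
    g + q * n + y      ≡⟨ +-assoc g _ y ⟩
    g + (q * n + y)    ∎

[[m+k]%n+[n∸m]]%n≡k : ∀ n .{{_ : NonZero n}} {m k} → m ≤ n → k < n → ((m + k) % n + (n ∸ m)) % n ≡ k
[[m+k]%n+[n∸m]]%n≡k n {m} {k} m≤n k<n = begin
  ((m + k) % n + (n ∸ m)) % n  ≡⟨ [m%n+k]%n≡[m+k]%n (m + k) (n ∸ m) n ⟩
  (m + k + (n ∸ m)) % n        ≡⟨ cong (_% n) (trans (xy∙z≈yz∙x m k (n ∸ m)) (m+[n∸o]+o≡m+n k m≤n)) ⟩
  (k + n) % n                  ≡⟨ [m+n]%n≡m%n k n ⟩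
  k % n                        ≡⟨ m<n⇒m%n≡m k<n ⟩
  k                            ∎
  where open ≡-Reasoning

subset : ∀ v {P : Pred ℕ 0ℓ} → Decidable P → List (Fin v)
subset v P? = filter (P? ∘ toℕ) (allFin v)

length-subset : ∀ v {P : Pred ℕ 0ℓ} (P? : Decidable P) → length (subset v P?) ≡ ∑[ x < v ] 𝟙 (P? x)
length-subset v P? = trans (length-filter≡sum (P? ∘ toℕ) (allFin v)) (sum-map-allFin v (𝟙 ∘ P?))

Δcount-subset : ∀ v .{{_ : NonZero v}} {P Q : Pred ℕ 0ℓ} (P? : Decidable P) (Q? : Decidable Q) (g : Fin v) →
  Δcount v (subset v P?) (subset v Q?) g ≡ ∑[ x < v ] (𝟙 (P? x) * 𝟙 (Q? ((x + (v ∸ toℕ g)) % v)))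
Δcount-subset v@(suc _) P? Q? g = begin
  length (filter R? (cartesianProduct A B))
    ≡⟨ length-filter≡sum R? (cartesianProduct A B) ⟩
  sum (map (𝟙 ∘ R?) (cartesianProduct A B))
    ≡⟨ sum-map-cartesianProduct A B _ ⟩
  sum (map (λ x → sum (map (λ y → 𝟙 (R? (x , y))) B)) A)
    ≡⟨ sum-map-filter (P? ∘ toℕ) (allFin v) _ ⟩
  sum (map (λ x → 𝟙 (P? (toℕ x)) * sum (map (λ y → 𝟙 (R? (x , y))) B)) (allFin v))
    ≡⟨ cong sum (map-cong (λ x → cong (𝟙 (P? (toℕ x)) *_) (differences x)) (allFin v)) ⟩
  sum (map (λ x → 𝟙 (P? (toℕ x)) * 𝟙 (Q? ((toℕ x + (v ∸ gₙ)) % v))) (allFin v))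
    ≡⟨ sum-map-allFin v (λ x → 𝟙 (P? x) * 𝟙 (Q? ((x + (v ∸ gₙ)) % v))) ⟩
  ∑[ x < v ] (𝟙 (P? x) * 𝟙 (Q? ((x + (v ∸ gₙ)) % v))) ∎
  where
  open ≡-Reasoning
  A = subset v P?
  B = subset v Q?
  gₙ = toℕ g
  g≤v = <⇒≤ (toℕ<n g)
  R? : Decidable (λ (p : Fin v × Fin v) → subℤ v (proj₁ p) (proj₂ p) ≡ gₙ)
  R? p = subℤ v (proj₁ p) (proj₂ p) ≟ gₙ
  differences : ∀ x → sum (map (λ y → 𝟙 (R? (x , y))) B) ≡ 𝟙 (Q? ((toℕ x + (v ∸ gₙ)) % v))
  differences x = begin
    sum (map (λ y → 𝟙 (R? (x , y))) B)
      ≡⟨ sum-map-filter (Q? ∘ toℕ) (allFin v) _ ⟩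
    sum (map (λ y → 𝟙 (Q? (toℕ y)) * 𝟙 (R? (x , y))) (allFin v))
      ≡⟨ sum-map-allFin v (λ y → 𝟙 (Q? y) * 𝟙 ((xₙ + (v ∸ y)) % v ≟ gₙ)) ⟩
    ∑[ y < v ] (𝟙 (Q? y) * 𝟙 ((xₙ + (v ∸ y)) % v ≟ gₙ))
      ≡⟨ ∑-select v (𝟙 ∘ Q?) (λ y → (xₙ + (v ∸ y)) % v ≟ gₙ) (m%n<n (xₙ + (v ∸ gₙ)) v)
                  x-y₀≡g y≡y₀ ⟩
    𝟙 (Q? y₀) ∎
    where
    xₙ = toℕ x
    y₀ = (xₙ + (v ∸ gₙ)) % v
    x-y₀≡g : (xₙ + (v ∸ y₀)) % v ≡ gₙ
    x-y₀≡g = trans ([m+[n∸o]]%n≡p⇒[m+[n∸p]]%n≡o%n v xₙ g≤v (m%n≤n (xₙ + (v ∸ gₙ)) v) refl)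
                   (m<n⇒m%n≡m (toℕ<n g))
    y≡y₀ : ∀ {y} → y < v → (xₙ + (v ∸ y)) % v ≡ gₙ → y ≡ y₀
    y≡y₀ y<v x-y≡g =
      sym (trans ([m+[n∸o]]%n≡p⇒[m+[n∸p]]%n≡o%n v xₙ (<⇒≤ y<v) g≤v x-y≡g) (m<n⇒m%n≡m y<v))

Δcount-subset′ : ∀ v .{{_ : NonZero v}} {P Q : Pred ℕ 0ℓ} (P? : Decidable P) (Q? : Decidable Q) (g : Fin v) →
  Δcount v (subset v P?) (subset v Q?) g ≡ ∑[ x < v ] (𝟙 (P? ((toℕ g + x) % v)) * 𝟙 (Q? x))
Δcount-subset′ v P? Q? g = begin
  Δcount v (subset v P?) (subset v Q?) g  ≡⟨ Δcount-subset v P? Q? g ⟩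
  ∑[ x < v ] f x                          ≡⟨ ∑-rotate-% v (toℕ g) f ⟨
  ∑[ x < v ] f ((toℕ g + x) % v)
    ≡⟨ ∑-cong v (λ {x} x<v → cong (λ y → 𝟙 (P? ((toℕ g + x) % v)) * 𝟙 (Q? y))
                                  ([[m+k]%n+[n∸m]]%n≡k v (<⇒≤ (toℕ<n g)) x<v)) ⟩
  ∑[ x < v ] (𝟙 (P? ((toℕ g + x) % v)) * 𝟙 (Q? x)) ∎
  where
  open ≡-Reasoning
  f : ℕ → ℕ
  f x = 𝟙 (P? x) * 𝟙 (Q? ((x + (v ∸ toℕ g)) % v))

div-exact : ∀ {x y z} .{{_ : NonZero y}} → x ≡ z * y → x div y ≡ z
div-exact {y = suc _} {z} refl = m*n/n≡m z _

mod≡% : ∀ x n .{{_ : NonZero n}} → x mod n ≡ x % n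
mod≡% x (suc _) = refl

lambdaMatrix-diagonal : ∀ v m k (i : Fin m) → lambdaMatrix v m k i i ≡ 0
lambdaMatrix-diagonal v m k i with i Fin.≟ i
... | yes _  = refl
... | no i≢i = contradiction refl i≢i

lambdaMatrix-offDiagonal : ∀ v m k {i j : Fin m} → i ≢ j → lambdaMatrix v m k i j ≡ (k i * k j) div v
lambdaMatrix-offDiagonal v m k {i} {j} i≢j with i Fin.≟ j
... | yes i≡j = contradiction i≡j i≢j
... | no _    = refl

module Construction
  (m : ℕ) (a b : ℕ → ℕ) (a>0 : ∀ i → i ≤ m → 0 < a i)
  (a≡b*a : ∀ i → i < m → 2 ≤ b (suc i) × a i ≡ b (suc i) * a (suc i))
  (η : ℕ → ℕ) (η-bounds : ∀ i → 1 ≤ i → i ≤ m → 1 ≤ η i × η i ≤ b i ∸ 1)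
  where

  v : ℕ
  v = a 0

  instance
    v-nonZero : NonZero v
    v-nonZero = >-nonZero (a>0 0 z≤n)

  a-nonZero : ∀ {i} → i ≤ m → NonZero (a i)
  a-nonZero {i} i≤m = >-nonZero (a>0 i i≤m)

  a-divides : ∀ {i j} → i ≤ j → j ≤ m → a j ∣ a i
  a-divides i≤j = go (≤⇒≤′ i≤j)
    where
    go : ∀ {i j} → i ≤′ j → j ≤ m → a j ∣ a i
    go ≤′-refl            _   = ∣-refl
    go (≤′-step {j} i≤j) j<m = ∣-trans (divides (b (suc j)) (proj₂ (a≡b*a j j<m))) (go i≤j (<⇒≤ j<m))

  -- Indices are shifted by one: L p, k p and A p are the paper's η_{p+1} a_{p+1}, k_{p+1}, A_{p+1}.
  L : ℕ → ℕ
  L p = η (suc p) * a (suc p)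

  L≤a : ∀ {p} → p < m → L p ≤ a p
  L≤a {p} p<m = begin
    η (suc p) * a (suc p)  ≤⟨ *-monoˡ-≤ (a (suc p)) η≤b ⟩
    b (suc p) * a (suc p)  ≡⟨ proj₂ (a≡b*a p p<m) ⟨
    a p                    ∎
    where
    open ≤-Reasoning
    η≤b = ≤-trans (proj₂ (η-bounds (suc p) (s≤s z≤n) p<m)) (m∸n≤m (b (suc p)) 1)

  k : ℕ → ℕ
  k p = blockSize a η (suc p)

  cofactor : ℕ → ℕ
  cofactor p = v div a p

  v≡cofactor*a : ∀ {p} → p ≤ m → v ≡ cofactor p * a p
  v≡cofactor*a {p} p≤m with a-divides z≤n p≤m
  ... | divides c v≡c*a = trans v≡c*a (cong (_* a p) (sym (div-exact {v} {a p} {c} v≡c*a)))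
    where instance _ = a-nonZero p≤m

  k≡L*cofactor : ∀ p → k p ≡ L p * cofactor p
  k≡L*cofactor zero    = sym (trans (cong (L 0 *_) (div-exact (sym (*-identityˡ v)))) (*-identityʳ (L 0)))
  k≡L*cofactor (suc p) = refl

  member? : ∀ p → Decidable (λ x → x mod a p < L p)
  member? p x = x mod a p <? L p

  A : ℕ → List (Fin v)
  A p = subset v (member? p)

  𝟙-member? : ∀ p .{{_ : NonZero (a p)}} x → 𝟙 (member? p x) ≡ 𝟙 (x % a p <? L p)
  𝟙-member? p x = cong (λ y → 𝟙 (y <? L p)) (mod≡% x (a p))

  length-A : ∀ {p} → p < m → length (A p) ≡ k p
  length-A {p} p<m = begin
    length (A p)
      ≡⟨ length-subset v (member? p) ⟩
    ∑[ x < v ] 𝟙 (member? p x)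
      ≡⟨ ∑-cong v (λ {x} _ → 𝟙-member? p x) ⟩
    ∑[ x < v ] 𝟙 (x % a p <? L p)
      ≡⟨ cong (λ n → ∑[ x < n ] 𝟙 (x % a p <? L p)) (v≡cofactor*a p≤m) ⟩
    ∑[ x < cofactor p * a p ] 𝟙 (x % a p <? L p)
      ≡⟨ ∑-cong (cofactor p * a p) (λ {x} _ → sym (*-identityʳ _)) ⟩
    ∑[ x < cofactor p * a p ] (𝟙 (x % a p <? L p) * 1)
      ≡⟨ ∑-%-truncate (cofactor p) (a p) (λ _ → 1) (L≤a p<m) (λ _ → refl) ⟩
    cofactor p * ∑[ x < L p ] 1
      ≡⟨ cong (cofactor p *_) (∑-ones (L p)) ⟩
    cofactor p * L p
      ≡⟨ *-comm (cofactor p) (L p) ⟩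
    L p * cofactor p
      ≡⟨ k≡L*cofactor p ⟨
    k p ∎
    where
    open ≡-Reasoning
    p≤m = <⇒≤ p<m
    instance _ = a-nonZero p≤m

  record Balanced (p q : ℕ) : Set where
    field
      index           : ℕ
      Δ-constant      : ΔIsMultipleOfG v (A p) (A q) index
      k*k≡index*v     : k p * k q ≡ index * v
      v*L*L≡index*a*a : v * L p * L q ≡ index * (a p * a q)

  module Ordered {p q} (p<q : p < q) (q<m : q < m) where
    private
      p≤m = <⇒≤ (<-trans p<q q<m)
      q≤m = <⇒≤ q<m
      instance
        _ = a-nonZero p≤m
        _ = a-nonZero q≤m
      aq∣v : a q ∣ v
      aq∣v = a-divides z≤n q≤m
      aq∣L : a q ∣ L p
      aq∣L = ∣-trans (a-divides p<q q≤m) (n∣m*n (η (suc p)))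
      e = quotient aq∣L
      L≡e*a : L p ≡ e * a q
      L≡e*a = _∣_.equality aq∣L
      𝟙-member?-%v : ∀ y → 𝟙 (member? q (y % v)) ≡ 𝟙 (y % a q <? L q)
      𝟙-member?-%v y =
        trans (𝟙-member? q (y % v)) (cong (λ z → 𝟙 (z <? L q)) (m∣n⇒o%n%m≡o%m (a q) v y aq∣v))

    index : ℕ
    index = cofactor p * (e * L q)

    ∑-pair : ∀ t → ∑[ x < v ] (𝟙 (x % a p <? L p) * 𝟙 ((t + x) % a q <? L q)) ≡ index
    ∑-pair t = ∑-blocks t (divides (cofactor p) (v≡cofactor*a p≤m)) (a-divides (<⇒≤ p<q) q≤m) aq∣L
                        (L≤a (<-trans p<q q<m)) (L≤a q<m)

    Δ-lower-upper : ΔIsMultipleOfG v (A p) (A q) index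
    Δ-lower-upper g = begin
      Δcount v (A p) (A q) g
        ≡⟨ Δcount-subset v (member? p) (member? q) g ⟩
      ∑[ x < v ] (𝟙 (member? p x) * 𝟙 (member? q ((x + (v ∸ toℕ g)) % v)))
        ≡⟨ ∑-cong v (λ {x} _ → cong₂ _*_ (𝟙-member? p x)
             (trans (𝟙-member?-%v (x + (v ∸ toℕ g))) (cong (λ z → 𝟙 (z % a q <? L q)) (+-comm x _)))) ⟩
      ∑[ x < v ] (𝟙 (x % a p <? L p) * 𝟙 ((v ∸ toℕ g + x) % a q <? L q))
        ≡⟨ ∑-pair (v ∸ toℕ g) ⟩
      index ∎
      where open ≡-Reasoning

    Δ-upper-lower : ΔIsMultipleOfG v (A q) (A p) index
    Δ-upper-lower g = begin
      Δcount v (A q) (A p) g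
        ≡⟨ Δcount-subset′ v (member? q) (member? p) g ⟩
      ∑[ x < v ] (𝟙 (member? q ((toℕ g + x) % v)) * 𝟙 (member? p x))
        ≡⟨ ∑-cong v (λ {x} _ → trans (*-comm (𝟙 (member? q ((toℕ g + x) % v))) (𝟙 (member? p x)))
                                     (cong₂ _*_ (𝟙-member? p x) (𝟙-member?-%v (toℕ g + x)))) ⟩
      ∑[ x < v ] (𝟙 (x % a p <? L p) * 𝟙 ((toℕ g + x) % a q <? L q))
        ≡⟨ ∑-pair (toℕ g) ⟩
      index ∎
      where open ≡-Reasoning

    k*k≡index*v : k p * k q ≡ index * v
    k*k≡index*v = begin
      k p * k q                                  ≡⟨ cong₂ _*_ (k≡L*cofactor p) (k≡L*cofactor q) ⟩
      L p * cofactor p * (L q * cofactor q)      ≡⟨ cong (λ z → z * cofactor p * (L q * cofactor q)) L≡e*a ⟩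
      e * a q * cofactor p * (L q * cofactor q)  ≡⟨ rearrange e (a q) (cofactor p) (L q) (cofactor q) ⟩
      index * (cofactor q * a q)                 ≡⟨ cong (index *_) (v≡cofactor*a q≤m) ⟨
      index * v                                  ∎
      where
      open ≡-Reasoning
      rearrange : ∀ e a c L c′ → e * a * c * (L * c′) ≡ c * (e * L) * (c′ * a)
      rearrange = solve-∀

    v*L*L≡index*a*a : v * L p * L q ≡ index * (a p * a q)
    v*L*L≡index*a*a = begin
      v * L p * L q                       ≡⟨ cong₂ (λ y z → y * z * L q) (v≡cofactor*a p≤m) L≡e*a ⟩
      cofactor p * a p * (e * a q) * L q  ≡⟨ rearrange (cofactor p) (a p) e (a q) (L q) ⟩
      index * (a p * a q)                 ∎
      where
      open ≡-Reasoning
      rearrange : ∀ c a e a′ L → c * a * (e * a′) * L ≡ c * (e * L) * (a * a′)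
      rearrange = solve-∀

  balanced : ∀ {p q} → p < m → q < m → p ≢ q → Balanced p q
  balanced {p} {q} p<m q<m p≢q with <-cmp p q
  ... | tri< p<q _ _ = record
    { index = index ; Δ-constant = Δ-lower-upper
    ; k*k≡index*v = k*k≡index*v ; v*L*L≡index*a*a = v*L*L≡index*a*a }
    where open Ordered p<q q<m
  ... | tri≈ _ p≡q _ = contradiction p≡q p≢q
  ... | tri> _ _ q<p = record
    { index = index ; Δ-constant = Δ-upper-lower
    ; k*k≡index*v = trans (*-comm (k p) (k q)) k*k≡index*v
    ; v*L*L≡index*a*a =
        trans (m*n*o≡m*o*n v (L p) (L q)) (trans v*L*L≡index*a*a (cong (index *_) (*-comm (a q) (a p)))) }
    where open Ordered q<p p<m

  balanced-Fin : ∀ {i j : Fin m} → i ≢ j → Balanced (toℕ i) (toℕ j)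
  balanced-Fin {i} {j} i≢j = balanced (toℕ<n i) (toℕ<n j) (i≢j ∘ toℕ-injective)

  gpsedf : IsGPSEDF v m (k ∘ toℕ) (A ∘ toℕ)
  gpsedf = (λ i → Unique.filter⁺ _ (Unique.allFin⁺ v) , length-A (toℕ<n i))
         , λ i j i≢j g → let open Balanced (balanced-Fin i≢j) in
                         trans (Δ-constant g) (sym (div-exact k*k≡index*v))

  lambdaMatrix-value : ∀ (i j : Fin m) → i ≢ j → lambdaMatrix v m (k ∘ toℕ) i j
                       ≡ (v * L (toℕ i) * L (toℕ j)) div (a (toℕ i) * a (toℕ j))
  lambdaMatrix-value i j i≢j = begin
    lambdaMatrix v m (k ∘ toℕ) i j                         ≡⟨ lambdaMatrix-offDiagonal v m (k ∘ toℕ) i≢j ⟩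
    (k (toℕ i) * k (toℕ j)) div v                          ≡⟨ div-exact k*k≡index*v ⟩
    index                                                  ≡⟨ div-exact v*L*L≡index*a*a ⟨
    (v * L (toℕ i) * L (toℕ j)) div (a (toℕ i) * a (toℕ j)) ∎
    where
    open ≡-Reasoning
    open Balanced (balanced-Fin i≢j)
    instance
      _ = m*n≢0 (a (toℕ i)) (a (toℕ j)) {{a-nonZero (<⇒≤ (toℕ<n i))}} {{a-nonZero (<⇒≤ (toℕ<n j))}}

theorem3p2 :
    (m : ℕ) → 2 ≤ m →
    (a b : ℕ → ℕ) →
    ((i : ℕ) → i ≤ m → 0 < a i) →
    ((i : ℕ) → i < m → 2 ≤ b (suc i) × a i ≡ b (suc i) * a (suc i)) →
    (η : ℕ → ℕ) →
    ((i : ℕ) → 1 ≤ i → i ≤ m → 1 ≤ η i × η i ≤ b i ∸ 1) →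
    Σ (Fin m → List (Fin (a 0))) λ A →
      IsGPSEDF (a 0) m (λ i → blockSize a η (pix i)) A ×
      ((i : Fin m) → lambdaMatrix (a 0) m (λ i → blockSize a η (pix i)) i i ≡ 0) ×
      ((i j : Fin m) → i ≢ j →
        lambdaMatrix (a 0) m (λ i → blockSize a η (pix i)) i j
          ≡ (a 0 * (η (pix i) * a (pix i)) * (η (pix j) * a (pix j)))
              div (a (pix i ∸ 1) * a (pix j ∸ 1)))
theorem3p2 m _ a b a>0 a≡b*a η η-bounds =
  A ∘ toℕ , gpsedf , lambdaMatrix-diagonal v m (k ∘ toℕ) , lambdaMatrix-value
  where open Construction m a b a>0 a≡b*a η η-bounds
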